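{- Let $A$ be a finite alphabet and $L \subseteq A^*$ a language. The following conditions are equivalent: (1) $L$ is context-free. (2) There exist a finite set $X$, a map $(o,\delta): X \to \mathbb{B} \times \mathcal{P}_\omega(X^*)^A$ and an $x \in X$ such that $[\![ \{x\} ]\!] = L$, where $[\![ - ]\!]$ is taken with respect to the extension $(\mathcal{P}_\omega(X^*), (\hat{o}, \hat{\delta}))$. (3) There exist a finite set $X$, a map $(o,\delta): X \to \mathbb{B} \times \mathcal{P}_\omega(X^*)^A$ and an $S \in \mathcal{P}_\omega(X^*)$ such that $[\![ S ]\!] = L$, with respect to the same extension.
   Context: $\mathbb{B}=\{0,1\}$ is the Boolean semiring; $\mathcal{P}_\omega(X^*)$ is the set of finite sets of words over $X$, with union and concatenation $ST=\{st \mid s\in S, t\in T\}$. Write $x_a := \delta(x)(a)$. Let $i:\mathbb{B}\to\mathcal{P}(X^*)$ be given by $i(1)=\{\epsilon\}$, $i(0)=\emptyset$. The extension $(\hat{o},\hat{\delta}): \mathcal{P}_\omega(X^*) \to \mathbb{B}\times\mathcal{P}_\omega(X^*)^A$ (write $S_a := \hat{\delta}(S)(a)$) is defined inductively by: $\hat{o}(\{\epsilon\})=1$, $\{\epsilon\}_a=\emptyset$; for $x \in X$, $w\in X^*$: $\hat{o}(\{xw\}) = o(x)\wedge \hat{o}(\{w\})$ and $\{xw\}_a = x_a\{w\} \cup i(o(x))\{w\}_a$; for a finite set $S$: $\hat{o}(S)=\bigvee_{s\in S}\hat{o}(\{s\})$ and $S_a=\bigcup_{s\in S}\{s\}_a$.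 Word derivatives: $S_\epsilon=S$, $S_{aw}=(S_a)_w$. The set $\mathcal{P}(A^*)$ of all languages is the final $\mathbb{B}\times(-)^A$-coalgebra with $o(L)=1$ iff $\epsilon\in L$ and $L_a=\{w \mid aw\in L\}$; $[\![-]\!]:\mathcal{P}_\omega(X^*)\to\mathcal{P}(A^*)$ is the unique coalgebra homomorphism, explicitly $[\![S]\!]=\{w\in A^* \mid \hat{o}(S_w)=1\}$. A language is context-free if it is generated from some nonterminal by a context-free grammar with finitely many nonterminals and finitely many productions. -}

module Defs where

open import Data.Nat using (ℕ)
open import Data.Fin using (Fin)
open import Data.Bool using (Bool; true; false; _∧_; _∨_)
open import Data.List using (List; []; _∷_; [_]; _++_; map; concatMap; foldr)
open import Data.List.Membership.Propositional using (_∈_)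
open import Data.Product using (_×_; _,_; Σ; ∃)
open import Data.Sum using (_⊎_; inj₁; inj₂)
open import Relation.Binary.PropositionalEquality using (_≡_)
open import Relation.Binary.Construct.Closure.ReflexiveTransitive using (Star)
open import Function.Bundles using (_⇔_)

Language : Set → Set₁
Language A = List A → Set

_≐_ : {A : Set} → Language A → Language A → Set
L ≐ K = ∀ w → L w ⇔ K w

record CFG (A : Set) : Set where
  field
    nNT   : ℕ
    prods : List (Fin nNT × List (Fin nNT ⊎ A))

module _ {A : Set} (G : CFG A) where
  open CFG G

  SentForm : Set
  SentForm = List (Fin nNT ⊎ A)

  data _⇒_ : SentForm → SentForm → Set where
    step : ∀ u v n α → (n , α) ∈ prods →
           (u ++ (inj₁ n ∷ v)) ⇒ (u ++ (α ++ v))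

  _⇒*_ : SentForm → SentForm → Set
  _⇒*_ = Star _⇒_

  generated : Fin nNT → Language A
  generated n w = (inj₁ n ∷ []) ⇒* map inj₂ w

IsContextFree : {A : Set} → Language A → Set
IsContextFree {A} L = Σ (CFG A) λ G → ∃ λ n → L ≐ generated G n

-- Finite sets of words P_ω(X*) represented as finite lists of words.

FinSetWords : Set → Set
FinSetWords X = List (List X)

_·_ : {X : Set} → FinSetWords X → FinSetWords X → FinSetWords X
S · T = concatMap (λ s → map (s ++_) T) S

ι : {X : Set} → Bool → FinSetWords X
ι true  = [ [] ]
ι false = []

module Extension {X A : Set} (o : X → Bool) (δ : X → A → FinSetWords X) where

  ôword : List X → Bool
  ôword []      = true
  ôword (x ∷ w) = o x ∧ ôword w

  δword : List X → A → FinSetWords X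
  δword []      a = []
  δword (x ∷ w) a = (δ x a · [ w ]) ++ (ι (o x) · δword w a)

  ô : FinSetWords X → Bool
  ô S = foldr (λ s b → ôword s ∨ b) false S

  δ̂ : FinSetWords X → A → FinSetWords X
  δ̂ S a = concatMap (λ s → δword s a) S

  deriv : FinSetWords X → List A → FinSetWords X
  deriv S []      = S
  deriv S (a ∷ w) = deriv (δ̂ S a) w

  ⟦_⟧ : FinSetWords X → Language A
  ⟦ S ⟧ w = ô (deriv S w) ≡ true

Condition2 : {A : Set} → Language A → Set
Condition2 {A} L =
  Σ ℕ λ m → Σ (Fin m → Bool) λ o → Σ (Fin m → A → FinSetWords (Fin m)) λ δ →
  Σ (Fin m) λ x → Extension.⟦_⟧ o δ ((x ∷ []) ∷ []) ≐ L

Condition3 : {A : Set} → Language A → Set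
Condition3 {A} L =
  Σ ℕ λ m → Σ (Fin m → Bool) λ o → Σ (Fin m → A → FinSetWords (Fin m)) λ δ →
  Σ (FinSetWords (Fin m)) λ S → Extension.⟦_⟧ o δ S ≐ L

-- A coalgebra (o, δ) on X is a grammar with nonterminals X in Greibach form: x → ε when o x = 1,
-- and x → a r for each r ∈ δ x a.  The languages ⟦ {x} ⟧ are the unique solution of this grammar:
-- ⟦ {u} ⟧ is the language of the pushdown automaton started with stack u, and for any solution I
-- a run on stack u splits along the letters of u into words of I u₁, …, I uₙ, and conversely.
-- This gives (2) ⇒ (1), and (3) ⇒ (2) by adding a fresh state that behaves like S.  For (1) ⇒ (2)
-- a context-free grammar is brought into this form by a left-corner construction: besides the
-- grammar symbols, the states are pairs (N, Z) standing for the rest of an N once its left corner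
-- Z has been read.  Nullability, and reachability through left corners with nullable right
-- context, are decided by least fixed-point iteration on finite subsets.

module Submission where

open import Defs
open import Data.Bool using (Bool; true; false; T)
open import Data.Bool.Properties using (T-≡; T-∧; T-∨)
open import Data.Fin using (Fin; zero; suc)
open import Data.List using (List; []; _∷_; [_]; _++_; map; concatMap; length; allFin)
open import Data.List.Properties using (++-assoc; ++-identityʳ; length-++; map-++)
open import Data.List.Membership.Propositional using (_∈_; find; lose)
open import Data.List.Membership.Propositional.Properties
  using (∈-++⁺ˡ; ∈-++⁺ʳ; ∈-++⁻; ∈-map⁺; ∈-map⁻; ∈-concatMap⁺; ∈-concatMap⁻; ∈-allFin)
open import Data.List.Relation.Unary.Any using (here; there)
open import Data.Nat using (ℕ; zero; suc; _+_; _≤_; s≤s)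
open import Data.Nat.Properties using (≤-refl; ≤-trans; m≤m+n; m≤n+m)
open import Data.Product using (_×_; _,_; ∃-syntax; proj₂)
open import Data.Sum using (_⊎_; inj₁; inj₂)
open import Function using (_∘_; case_of_)
open import Function.Bundles using (_⇔_; mk⇔; Equivalence)
open import Function.Properties.Equivalence using () renaming (refl to ⇔-refl; trans to ⇔-trans; sym to ⇔-sym)
open import Relation.Binary.PropositionalEquality
  using (_≡_; refl; sym; trans; cong; subst; subst₂)
open import Relation.Binary.Construct.Closure.ReflexiveTransitive using (ε; _◅_; _◅◅_; gmap)

open Equivalence using (to; from)

∈-concatMap⁺′ : ∀ {X Y : Set} (f : X → List Y) {x y xs} → x ∈ xs → y ∈ f x → y ∈ concatMap f xs
∈-concatMap⁺′ f x∈xs y∈fx = ∈-concatMap⁺ f (lose x∈xs y∈fx)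

∈-concatMap⁻′ : ∀ {X Y : Set} (f : X → List Y) {y} xs → y ∈ concatMap f xs → ∃[ x ] x ∈ xs × y ∈ f x
∈-concatMap⁻′ f xs y∈ = find (∈-concatMap⁻ f {xs} y∈)

∃∈-cong : ∀ {X : Set} {P Q : X → Set} {xs} → (∀ x → P x ⇔ Q x) →
          (∃[ x ] x ∈ xs × P x) ⇔ (∃[ x ] x ∈ xs × Q x)
∃∈-cong P⇔Q = mk⇔ (λ (x , x∈ , p) → x , x∈ , to (P⇔Q x) p) (λ (x , x∈ , q) → x , x∈ , from (P⇔Q x) q)

∃∈-map⇔ : ∀ {X Y : Set} {P : X → Set} {Q : Y → Set} {xs} (f : X → Y) → (∀ x → P x ⇔ Q (f x)) →
          (∃[ x ] x ∈ xs × P x) ⇔ (∃[ y ] y ∈ map f xs × Q y)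
∃∈-map⇔ {Q = Q} f P⇔Qf = mk⇔
  (λ (x , x∈ , p) → f x , ∈-map⁺ f x∈ , to (P⇔Qf x) p)
  (λ (y , y∈ , q) → let x , x∈ , y≡fx = ∈-map⁻ f y∈ in x , x∈ , from (P⇔Qf x) (subst Q y≡fx q))

∃∈-concatMap⇔ : ∀ {X Y : Set} {P : Y → Set} {xs} (f : X → List Y) →
                (∃[ y ] y ∈ concatMap f xs × P y) ⇔ (∃[ x ] x ∈ xs × ∃[ y ] y ∈ f x × P y)
∃∈-concatMap⇔ {xs = xs} f = mk⇔
  (λ (y , y∈ , p) → let x , x∈ , y∈fx = ∈-concatMap⁻′ f xs y∈ in x , x∈ , y , y∈fx , p)
  (λ (x , x∈ , y , y∈fx , p) → y , ∈-concatMap⁺′ f x∈ y∈fx , p)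

when : {X : Set} → Bool → List X → List X
when true  xs = xs
when false xs = []

∈-when⇔ : ∀ {X : Set} b {xs} {x : X} → x ∈ when b xs ⇔ (T b × x ∈ xs)
∈-when⇔ true  = mk⇔ (λ x∈ → _ , x∈) proj₂
∈-when⇔ false = mk⇔ (λ ()) (λ ())

record Concat {A : Set} (L K : Language A) (w : List A) : Set where
  constructor split
  field
    u v   : List A
    w≡uv  : w ≡ u ++ v
    u∈L   : L u
    v∈K   : K v

_⟪_⟫ : {X A : Set} → (X → Language A) → List X → Language A
(I ⟪ []    ⟫) w = w ≡ []
(I ⟪ x ∷ u ⟫)   = Concat (I x) (I ⟪ u ⟫)

module _ {X A : Set} {I : X → Language A} where

  ⟪⟫-++⁺ : ∀ u {v w₁ w₂} → (I ⟪ u ⟫) w₁ → (I ⟪ v ⟫) w₂ → (I ⟪ u ++ v ⟫) (w₁ ++ w₂)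
  ⟪⟫-++⁺ []      refl q = q
  ⟪⟫-++⁺ (x ∷ u) {w₂ = w₂} (split w₁ w₁′ refl p ps) q =
    split w₁ (w₁′ ++ w₂) (++-assoc w₁ w₁′ w₂) p (⟪⟫-++⁺ u ps q)

  ⟪⟫-++⁻ : ∀ u {v w} → (I ⟪ u ++ v ⟫) w → Concat (I ⟪ u ⟫) (I ⟪ v ⟫) w
  ⟪⟫-++⁻ []      q = split [] _ refl refl q
  ⟪⟫-++⁻ (x ∷ u) (split w₁ w₂ refl p q) with ⟪⟫-++⁻ u q
  ... | split w₂′ w₂″ refl q′ q″ =
    split (w₁ ++ w₂′) w₂″ (sym (++-assoc w₁ w₂′ w₂″)) (split w₁ w₂′ refl p q′) q″

  ⟪[_]⟫⇔ : ∀ x {w} → (I ⟪ [ x ] ⟫) w ⇔ I x w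
  ⟪[ x ]⟫⇔ {w} = mk⇔ (λ { (split u .[] eq p refl) → subst (I x) (sym (trans eq (++-identityʳ u))) p })
                      (λ p → split w [] (sym (++-identityʳ w)) p refl)

⟪⟫-map : ∀ {X Y A : Set} {I : X → Language A} {J : Y → Language A} (f : X → Y) →
         (∀ x w → I x w ⇔ J (f x) w) → ∀ u w → (I ⟪ u ⟫) w ⇔ (J ⟪ map f u ⟫) w
⟪⟫-map {I = I} {J} f I⇔J u w = mk⇔ (forth u) (back u)
  where
  forth : ∀ u {w} → (I ⟪ u ⟫) w → (J ⟪ map f u ⟫) w
  forth []      p                  = p
  forth (x ∷ u) (split w₁ w₂ e p q) = split w₁ w₂ e (to (I⇔J x w₁) p) (forth u q)
  back : ∀ u {w} → (J ⟪ map f u ⟫) w → (I ⟪ u ⟫) w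
  back []      p                  = p
  back (x ∷ u) (split w₁ w₂ e p q) = split w₁ w₂ e (from (I⇔J x w₁) p) (back u q)

module _ {X : Set} where

  ∈-·[]⇔ : ∀ (S : FinSetWords X) u {t} → t ∈ S · [ u ] ⇔ (∃[ r ] r ∈ S × t ≡ r ++ u)
  ∈-·[]⇔ S u = mk⇔ forth (λ { (r , r∈S , refl) → ∈-concatMap⁺′ (λ s → map (s ++_) [ u ]) r∈S (here refl) })
    where
    forth : ∀ {t} → t ∈ S · [ u ] → ∃[ r ] r ∈ S × t ≡ r ++ u
    forth t∈ with ∈-concatMap⁻′ (λ s → map (s ++_) [ u ]) S t∈
    ... | r , r∈S , here t≡ru = r , r∈S , t≡ru

  ∈-ι·⇔ : ∀ b (S : FinSetWords X) {t} → t ∈ ι b · S ⇔ (T b × t ∈ S)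
  ∈-ι·⇔ true  S = mk⇔ (λ t∈ → _ , ∈-++⁻-[] t∈) (λ (_ , t∈S) → ∈-++⁺ˡ (∈-map⁺ ([] ++_) t∈S))
    where
    ∈-++⁻-[] : ∀ {t} → t ∈ map ([] ++_) S ++ [] → t ∈ S
    ∈-++⁻-[] t∈ with ∈-++⁻ (map ([] ++_) S) t∈
    ... | inj₁ t∈map with ∈-map⁻ ([] ++_) t∈map
    ...   | s , s∈S , refl = s∈S
  ∈-ι·⇔ false S = mk⇔ (λ ()) (λ ())

record IsSolution {X A : Set} (o : X → Bool) (δ : X → A → FinSetWords X) (I : X → Language A) : Set where
  field
    ε⇔ : ∀ x → I x [] ⇔ T (o x)
    ∷⇔ : ∀ x a w → I x (a ∷ w) ⇔ (∃[ r ] r ∈ δ x a × (I ⟪ r ⟫) w)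

module Operational {X A : Set} (o : X → Bool) (δ : X → A → FinSetWords X) where
  open Extension o δ

  -- Runs of the pushdown automaton with stack u: the top x is popped if o x, or replaced by
  -- r ∈ δ x a while reading a.
  data Accepts : List X → List A → Set where
    done : Accepts [] []
    skip : ∀ {x u w} → T (o x) → Accepts u w → Accepts (x ∷ u) w
    read : ∀ {x u a w r} → r ∈ δ x a → Accepts (r ++ u) w → Accepts (x ∷ u) (a ∷ w)

  Accepts-++⁺ : ∀ {u v w₁ w₂} → Accepts u w₁ → Accepts v w₂ → Accepts (u ++ v) (w₁ ++ w₂)
  Accepts-++⁺ done         q = q
  Accepts-++⁺ (skip p acc) q = skip p (Accepts-++⁺ acc q)
  Accepts-++⁺ {x ∷ u} {v} (read {r = r} r∈δ acc) q =
    read r∈δ (subst (λ t → Accepts t _) (++-assoc r u v) (Accepts-++⁺ acc q))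

  Accepts-++⁻ : ∀ u {v w} → Accepts (u ++ v) w → Concat (Accepts u) (Accepts v) w
  Accepts-++⁻ u acc = go acc u refl
    where
    go : ∀ {t w} → Accepts t w → ∀ u {v} → t ≡ u ++ v → Concat (Accepts u) (Accepts v) w
    go acc [] refl = split [] _ refl done acc
    go (skip p acc) (x ∷ u) refl with go acc u refl
    ... | split w₁ w₂ refl p₁ p₂ = split w₁ w₂ refl (skip p p₁) p₂
    go (read {a = a} {r = r} r∈δ acc) (x ∷ u) {v} refl with go acc (r ++ u) (sym (++-assoc r u v))
    ... | split w₁ w₂ refl p₁ p₂ = split (a ∷ w₁) w₂ refl (read r∈δ p₁) p₂

  ôword⇔ : ∀ u → T (ôword u) ⇔ Accepts u []
  ôword⇔ []      = mk⇔ (λ _ → done) (λ _ → _)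
  ôword⇔ (x ∷ u) = mk⇔
    (λ t → let p , q = to (T-∧ {o x}) t in skip p (to (ôword⇔ u) q))
    (λ { (skip p acc) → from T-∧ (p , from (ôword⇔ u) acc) })

  ô⇔ : ∀ S → T (ô S) ⇔ (∃[ u ] u ∈ S × T (ôword u))
  ô⇔ []      = mk⇔ (λ ()) (λ { (_ , () , _) })
  ô⇔ (s ∷ S) = mk⇔ forth back
    where
    forth : T (ô (s ∷ S)) → ∃[ u ] u ∈ s ∷ S × T (ôword u)
    forth t with to (T-∨ {ôword s}) t
    ... | inj₁ p = s , here refl , p
    ... | inj₂ p = let u , u∈S , q = to (ô⇔ S) p in u , there u∈S , q
    back : ∃[ u ] u ∈ s ∷ S × T (ôword u) → T (ô (s ∷ S))
    back (u , here refl , q) = from T-∨ (inj₁ q)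
    back (u , there u∈S , q) = from (T-∨ {ôword s}) (inj₂ (from (ô⇔ S) (u , u∈S , q)))

  δword⇔ : ∀ s {a w} → (∃[ t ] t ∈ δword s a × Accepts t w) ⇔ Accepts s (a ∷ w)
  δword⇔ s = mk⇔ (forth s) back
    where
    forth : ∀ s {a w} → ∃[ t ] t ∈ δword s a × Accepts t w → Accepts s (a ∷ w)
    forth (x ∷ u) {a} (t , t∈ , acc) with ∈-++⁻ (δ x a · [ u ]) t∈
    ... | inj₁ t∈δ with to (∈-·[]⇔ (δ x a) u) t∈δ
    ...   | r , r∈δ , refl = read r∈δ acc
    forth (x ∷ u) {a} (t , t∈ , acc) | inj₂ t∈ι with to (∈-ι·⇔ (o x) (δword u a)) t∈ι
    ...   | p , t∈δu = skip p (forth u (t , t∈δu , acc))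
    back : ∀ {s a w} → Accepts s (a ∷ w) → ∃[ t ] t ∈ δword s a × Accepts t w
    back (skip {x} {u} p acc) with back acc
    ... | t , t∈ , acc′ = t , ∈-++⁺ʳ (δ x _ · [ u ]) (from (∈-ι·⇔ (o x) (δword u _)) (p , t∈)) , acc′
    back (read {x} {u} {a} {r = r} r∈δ acc) =
      r ++ u , ∈-++⁺ˡ (from (∈-·[]⇔ (δ x a) u) (r , r∈δ , refl)) , acc

  ⟦⟧⇔ : ∀ S w → ⟦ S ⟧ w ⇔ (∃[ u ] u ∈ S × Accepts u w)
  ⟦⟧⇔ S []      = ⇔-trans (⇔-sym T-≡) (⇔-trans (ô⇔ S) (∃∈-cong ôword⇔))
  ⟦⟧⇔ S (a ∷ w) = ⇔-trans (⟦⟧⇔ (δ̂ S a) w) (⇔-trans (∃∈-concatMap⇔ (λ s → δword s a)) (∃∈-cong (λ s → δword⇔ s)))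

  ⟦[_]⟧⇔ : ∀ u {w} → ⟦ [ u ] ⟧ w ⇔ Accepts u w
  ⟦[ u ]⟧⇔ {w} = ⇔-trans (⟦⟧⇔ [ u ] w) (mk⇔ (λ { (_ , here refl , acc) → acc }) (λ acc → u , here refl , acc))

  Accepts-letterwise : ∀ u {w} → Accepts u w ⇔ ((λ x → Accepts [ x ]) ⟪ u ⟫) w
  Accepts-letterwise u = mk⇔ (forth u) (back u)
    where
    forth : ∀ u {w} → Accepts u w → ((λ x → Accepts [ x ]) ⟪ u ⟫) w
    forth []      done = refl
    forth (x ∷ u) acc with Accepts-++⁻ [ x ] acc
    ... | split w₁ w₂ e p q = split w₁ w₂ e p (forth u q)
    back : ∀ u {w} → ((λ x → Accepts [ x ]) ⟪ u ⟫) w → Accepts u w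
    back []      refl                   = done
    back (x ∷ u) (split w₁ w₂ refl p q) = Accepts-++⁺ p (back u q)

  Accepts-[_]∷⇔ : ∀ x {a w} → Accepts [ x ] (a ∷ w) ⇔ (∃[ r ] r ∈ δ x a × Accepts r w)
  Accepts-[ x ]∷⇔ = mk⇔
    (λ { (skip _ ()) ; (read {r = r} r∈δ acc) → r , r∈δ , subst (λ t → Accepts t _) (++-identityʳ r) acc })
    (λ (r , r∈δ , acc) → read r∈δ (subst (λ t → Accepts t _) (sym (++-identityʳ r)) acc))

  Accepts-isSolution : IsSolution o δ (λ x → Accepts [ x ])
  Accepts-isSolution = record
    { ε⇔ = λ x → mk⇔ (λ { (skip p done) → p }) (λ p → skip p done)
    ; ∷⇔ = λ x a w → ⇔-trans Accepts-[ x ]∷⇔ (∃∈-cong (λ r → Accepts-letterwise r))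
    }

  module _ {I : X → Language A} (sol : IsSolution o δ I) where
    open IsSolution sol

    Accepts⇒⟪⟫ : ∀ {u w} → Accepts u w → (I ⟪ u ⟫) w
    Accepts⇒⟪⟫ done         = refl
    Accepts⇒⟪⟫ (skip p acc) = split [] _ refl (from (ε⇔ _) p) (Accepts⇒⟪⟫ acc)
    Accepts⇒⟪⟫ (read {x} {u} {a} {r = r} r∈δ acc) with ⟪⟫-++⁻ r (Accepts⇒⟪⟫ acc)
    ... | split w₁ w₂ refl p q = split (a ∷ w₁) w₂ refl (from (∷⇔ x a w₁) (r , r∈δ , p)) q

    ⟪⟫⇒Accepts : ∀ n u w → length w ≤ n → (I ⟪ u ⟫) w → Accepts u w
    ⟪⟫⇒Accepts n       []      w _ refl = done
    ⟪⟫⇒Accepts n       (x ∷ u) w |w|≤n (split [] w₂ refl p q) = skip (to (ε⇔ x) p) (⟪⟫⇒Accepts n u w₂ |w|≤n q)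
    ⟪⟫⇒Accepts (suc n) (x ∷ u) w (s≤s |w|≤n) (split (a ∷ w₁) w₂ refl p q) with to (∷⇔ x a w₁) p
    ... | r , r∈δ , pr = read r∈δ (Accepts-++⁺ (⟪⟫⇒Accepts n r w₁ |w₁|≤n pr) (⟪⟫⇒Accepts n u w₂ |w₂|≤n q))
      where
      |w₁w₂|≤n : length w₁ + length w₂ ≤ n
      |w₁w₂|≤n = subst (_≤ n) (length-++ w₁) |w|≤n
      |w₁|≤n : length w₁ ≤ n
      |w₁|≤n = ≤-trans (m≤m+n (length w₁) (length w₂)) |w₁w₂|≤n
      |w₂|≤n : length w₂ ≤ n
      |w₂|≤n = ≤-trans (m≤n+m (length w₂) (length w₁)) |w₁w₂|≤n

    solution-unique : ∀ x w → I x w ⇔ ⟦ [ [ x ] ] ⟧ w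
    solution-unique x w = ⇔-sym (⇔-trans ⟦[ [ x ] ]⟧⇔
      (⇔-trans (mk⇔ Accepts⇒⟪⟫ (⟪⟫⇒Accepts (length w) [ x ] w ≤-refl)) (⟪[_]⟫⇔ {I = I} x)))

module _ {X Y A : Set} {o : X → Bool} {δ : X → A → FinSetWords X} {I : X → Language A}
         (enc : X → Y) (dec : Y → X) (dec∘enc : ∀ x → dec (enc x) ≡ x) where

  relabel-isSolution : IsSolution o δ I →
    IsSolution (o ∘ dec) (λ y a → map (map enc) (δ (dec y) a)) (I ∘ dec)
  relabel-isSolution sol = record
    { ε⇔ = ε⇔ ∘ dec
    ; ∷⇔ = λ y a w → ⇔-trans (∷⇔ (dec y) a w) (∃∈-map⇔ (map enc) (λ r → ⟪⟫-map enc I⇔I∘dec∘enc r w))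
    }
    where
    open IsSolution sol
    I⇔I∘dec∘enc : ∀ x w → I x w ⇔ I (dec (enc x)) w
    I⇔I∘dec∘enc x w = mk⇔ (subst (λ z → I z w) (sym (dec∘enc x))) (subst (λ z → I z w) (dec∘enc x))

module _ {A : Set} (G : CFG A) where
  open CFG G

  data Parse : SentForm G → List A → Set where
    []   : Parse [] []
    term : ∀ {a α w} → Parse α w → Parse (inj₂ a ∷ α) (a ∷ w)
    node : ∀ {n γ α w w₁ w₂} → (n , γ) ∈ prods → Parse γ w₁ → Parse α w₂ → w ≡ w₁ ++ w₂ →
           Parse (inj₁ n ∷ α) w

  Parse-++⁺ : ∀ {α β w₁ w₂} → Parse α w₁ → Parse β w₂ → Parse (α ++ β) (w₁ ++ w₂)
  Parse-++⁺ []       q = q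
  Parse-++⁺ (term p) q = term (Parse-++⁺ p q)
  Parse-++⁺ {w₂ = w₂} (node {w₁ = u} {v} n→γ p₁ p₂ refl) q =
    node n→γ p₁ (Parse-++⁺ p₂ q) (++-assoc u v w₂)

  Parse-++⁻ : ∀ α {β w} → Parse (α ++ β) w → Concat (Parse α) (Parse β) w
  Parse-++⁻ []            p = split [] _ refl [] p
  Parse-++⁻ (inj₂ a ∷ α) (term p) with Parse-++⁻ α p
  ... | split u v refl p₁ p₂ = split (a ∷ u) v refl (term p₁) p₂
  Parse-++⁻ (inj₁ n ∷ α) (node {w₁ = t} n→γ pγ p refl) with Parse-++⁻ α p
  ... | split u v refl p₁ p₂ = split (t ++ u) v (sym (++-assoc t u v)) (node n→γ pγ p₁ refl) p₂

  ⟪Parse⟫⇔Parse : ∀ α {w} → ((λ s → Parse [ s ]) ⟪ α ⟫) w ⇔ Parse α w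
  ⟪Parse⟫⇔Parse α = mk⇔ (forth α) (back α)
    where
    forth : ∀ α {w} → ((λ s → Parse [ s ]) ⟪ α ⟫) w → Parse α w
    forth []      refl                 = []
    forth (s ∷ α) (split _ _ refl p q) = Parse-++⁺ p (forth α q)
    back : ∀ α {w} → Parse α w → ((λ s → Parse [ s ]) ⟪ α ⟫) w
    back []      []  = refl
    back (s ∷ α) p with Parse-++⁻ [ s ] p
    ... | split u v e pu pv = split u v e pu (back α pv)

  Parse-terminals : ∀ w → Parse (map inj₂ w) w
  Parse-terminals []      = []
  Parse-terminals (a ∷ w) = term (Parse-terminals w)

  Parse-⇐ : ∀ {α β w} → _⇒_ G α β → Parse β w → Parse α w
  Parse-⇐ (step u v n γ n→γ) p with Parse-++⁻ u p
  ... | split _ _ refl pu q with Parse-++⁻ γ q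
  ... | split _ _ refl pγ pv = Parse-++⁺ pu (node n→γ pγ pv refl)

  ⇒-prefix : ∀ π {α β} → _⇒_ G α β → _⇒_ G (π ++ α) (π ++ β)
  ⇒-prefix π (step u v n γ n→γ) =
    subst₂ (_⇒_ G) (++-assoc π u (inj₁ n ∷ v)) (++-assoc π u (γ ++ v)) (step (π ++ u) v n γ n→γ)

  ⇒-suffix : ∀ σ {α β} → _⇒_ G α β → _⇒_ G (α ++ σ) (β ++ σ)
  ⇒-suffix σ (step u v n γ n→γ) =
    subst₂ (_⇒_ G) (sym (++-assoc u (inj₁ n ∷ v) σ))
      (trans (cong (u ++_) (sym (++-assoc γ v σ))) (sym (++-assoc u (γ ++ v) σ)))
      (step u (v ++ σ) n γ n→γ)

  Parse⇒⇒* : ∀ {α w} → Parse α w → _⇒*_ G α (map inj₂ w)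
  Parse⇒⇒* []       = ε
  Parse⇒⇒* (term {a} p) = gmap (inj₂ a ∷_) (⇒-prefix [ inj₂ a ]) (Parse⇒⇒* p)
  Parse⇒⇒* (node {n} {γ} {α} {w₁ = w₁} {w₂} n→γ pγ p refl) =
    step [] α n γ n→γ ◅ (gmap (_++ α) (⇒-suffix α) (Parse⇒⇒* pγ) ◅◅
      subst (_⇒*_ G (map inj₂ w₁ ++ α)) (sym (map-++ inj₂ w₁ w₂))
        (gmap (map inj₂ w₁ ++_) (⇒-prefix (map inj₂ w₁)) (Parse⇒⇒* p)))

  ⇒*⇒Parse : ∀ {α w} → _⇒*_ G α (map inj₂ w) → Parse α w
  ⇒*⇒Parse {w = w} ε = Parse-terminals w
  ⇒*⇒Parse (s ◅ ss) = Parse-⇐ s (⇒*⇒Parse ss)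

  generated⇔Parse : ∀ n w → generated G n w ⇔ Parse [ inj₁ n ] w
  generated⇔Parse n w = mk⇔ ⇒*⇒Parse Parse⇒⇒*

module CoalgebraGrammar {k m : ℕ} (o : Fin m → Bool) (δ : Fin m → Fin k → FinSetWords (Fin m)) where

  Production : Set
  Production = Fin m × List (Fin m ⊎ Fin k)

  letterProduction : Fin m → Fin k → List (Fin m) → Production
  letterProduction x a r = x , inj₂ a ∷ map inj₁ r

  productionsOf : Fin m → List Production
  productionsOf x = when (o x) [ (x , []) ]
                 ++ concatMap (λ a → map (letterProduction x a) (δ x a)) (allFin k)

  grammar : CFG (Fin k)
  grammar = record { nNT = m ; prods = concatMap productionsOf (allFin m) }

  open CFG grammar using (prods)

  ε-production : ∀ {x} → T (o x) → (x , []) ∈ prods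
  ε-production {x} ox = ∈-concatMap⁺′ productionsOf (∈-allFin x) (∈-++⁺ˡ (from (∈-when⇔ (o x)) (ox , here refl)))

  letter-production : ∀ {x a r} → r ∈ δ x a → letterProduction x a r ∈ prods
  letter-production {x} {a} r∈δ = ∈-concatMap⁺′ productionsOf (∈-allFin x)
    (∈-++⁺ʳ (when (o x) _) (∈-concatMap⁺′ (λ a → map (letterProduction x a) (δ x a)) (∈-allFin a) (∈-map⁺ _ r∈δ)))

  data IsProduction (x : Fin m) : List (Fin m ⊎ Fin k) → Set where
    ε-rule      : T (o x) → IsProduction x []
    letter-rule : ∀ {a r} → r ∈ δ x a → IsProduction x (inj₂ a ∷ map inj₁ r)

  production⁻ : ∀ {x γ} → (x , γ) ∈ prods → IsProduction x γ
  production⁻ p∈ with ∈-concatMap⁻′ productionsOf (allFin m) p∈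
  ... | y , _ , p∈y with ∈-++⁻ (when (o y) _) p∈y
  ...   | inj₁ p∈ε with to (∈-when⇔ (o y)) p∈ε
  ...     | oy , here refl = ε-rule oy
  production⁻ p∈ | y , _ , p∈y | inj₂ p∈δ with ∈-concatMap⁻′ (λ a → map (letterProduction y a) (δ y a)) (allFin k) p∈δ
  ...     | a , _ , p∈δa with ∈-map⁻ (letterProduction y a) p∈δa
  ...       | r , r∈δ , refl = letter-rule r∈δ

  meaning : Fin m → Language (Fin k)
  meaning x = Parse grammar [ inj₁ x ]

  ⟪⟫⇔Parse : ∀ r w → (meaning ⟪ r ⟫) w ⇔ Parse grammar (map inj₁ r) w
  ⟪⟫⇔Parse r w = ⇔-trans (⟪⟫-map inj₁ (λ _ _ → ⇔-refl) r w) (⟪Parse⟫⇔Parse grammar (map inj₁ r))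

  meaning-isSolution : IsSolution o δ meaning
  meaning-isSolution = record
    { ε⇔ = λ x → mk⇔ ε-forth (λ ox → node (ε-production ox) [] [] refl)
    ; ∷⇔ = λ x a w → mk⇔ ∷-forth λ (r , r∈δ , p) →
        node (letter-production r∈δ) (term (to (⟪⟫⇔Parse r w) p)) [] (sym (++-identityʳ _))
    }
    where
    ε-forth : ∀ {x} → meaning x [] → T (o x)
    ε-forth (node x→γ pγ [] e) with production⁻ x→γ | pγ | e
    ... | ε-rule ox    | _      | _  = ox
    ... | letter-rule _ | term _ | ()
    ∷-forth : ∀ {x a w} → meaning x (a ∷ w) → ∃[ r ] r ∈ δ x a × (meaning ⟪ r ⟫) w
    ∷-forth (node x→γ pγ [] e) with production⁻ x→γ | pγ | e
    ... | ε-rule _ | [] | ()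
    ... | letter-rule {r = r} r∈δ | term {w = w₁} p | refl =
      r , r∈δ , from (⟪⟫⇔Parse r _) (subst (Parse grammar (map inj₁ r)) (sym (++-identityʳ w₁)) p)

  generated⇔⟦⟧ : ∀ x w → generated grammar x w ⇔ Extension.⟦_⟧ o δ [ [ x ] ] w
  generated⇔⟦⟧ x w =
    ⇔-trans (generated⇔Parse grammar x w) (Operational.solution-unique o δ meaning-isSolution x w)

module FreshState {k m : ℕ} (o : Fin m → Bool) (δ : Fin m → Fin k → FinSetWords (Fin m))
                    (S : FinSetWords (Fin m)) where
  open Extension o δ
  open Operational o δ

  o⁺ : Fin (suc m) → Bool
  o⁺ zero    = ô S
  o⁺ (suc x) = o x

  δ⁺ : Fin (suc m) → Fin k → FinSetWords (Fin (suc m))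
  δ⁺ zero    a = map (map suc) (δ̂ S a)
  δ⁺ (suc x) a = map (map suc) (δ x a)

  meaning : Fin (suc m) → Language (Fin k)
  meaning zero    = ⟦ S ⟧
  meaning (suc x) = Accepts [ x ]

  Accepts⇔⟪meaning⟫ : ∀ u w → Accepts u w ⇔ (meaning ⟪ map suc u ⟫) w
  Accepts⇔⟪meaning⟫ u w = ⇔-trans (Accepts-letterwise u) (⟪⟫-map suc (λ _ _ → ⇔-refl) u w)

  meaning-isSolution : IsSolution o⁺ δ⁺ meaning
  meaning-isSolution = record { ε⇔ = ε⇔ ; ∷⇔ = ∷⇔ }
    where
    ε⇔ : ∀ x → meaning x [] ⇔ T (o⁺ x)
    ε⇔ zero    = ⇔-sym T-≡
    ε⇔ (suc x) = IsSolution.ε⇔ Accepts-isSolution x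
    ∷⇔ : ∀ x a w → meaning x (a ∷ w) ⇔ (∃[ r ] r ∈ δ⁺ x a × (meaning ⟪ r ⟫) w)
    ∷⇔ zero    a w = ⇔-trans (⟦⟧⇔ (δ̂ S a) w) (∃∈-map⇔ (map suc) (λ u → Accepts⇔⟪meaning⟫ u w))
    ∷⇔ (suc x) a w = ⇔-trans Accepts-[ x ]∷⇔ (∃∈-map⇔ (map suc) (λ u → Accepts⇔⟪meaning⟫ u w))

  ⟦fresh⟧⇔⟦S⟧ : ∀ w → Extension.⟦_⟧ o⁺ δ⁺ [ [ zero ] ] w ⇔ ⟦ S ⟧ w
  ⟦fresh⟧⇔⟦S⟧ w = ⇔-sym (Operational.solution-unique o⁺ δ⁺ meaning-isSolution zero w)

module LeastFixedPoint where
  open import Data.Fin.Subset using (Subset; _⊆_; _⊂_; ⊥; ⊤; ∣_∣) renaming (_∈_ to _∈ₛ_)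
  open import Data.Fin.Subset.Properties using (_∈?_; ⊥⊆; ∉⊥; ∈⊤; ∣p∣≤n; ∣p∣≡n⇒p≡⊤; _⊂?_; p⊂q⇒∣p∣<∣q∣)
  open import Data.Nat using (z≤n)
  open import Data.Nat.Properties using (≤-antisym)
  open import Data.Vec using (tabulate)
  open import Data.Vec.Properties using (lookup⇒[]=; []=⇒lookup; lookup∘tabulate)
  open import Relation.Nullary using (yes; no; ¬_; contradiction)
  open import Relation.Nullary.Decidable using (isYes; toWitness; fromWitness)
  open import Relation.Unary using (Decidable)

  subsetOf : ∀ {m} {P : Fin m → Set} → Decidable P → Subset m
  subsetOf P? = tabulate (isYes ∘ P?)

  ∈-subsetOf⇔ : ∀ {m} {P : Fin m → Set} (P? : Decidable P) {i} → i ∈ₛ subsetOf P? ⇔ P i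
  ∈-subsetOf⇔ P? {i} = mk⇔
    (λ i∈ → toWitness {a? = P? i} (from T-≡ (trans (sym (lookup∘tabulate (isYes ∘ P?) i)) ([]=⇒lookup i∈))))
    (λ Pi → lookup⇒[]= i _ (trans (lookup∘tabulate (isYes ∘ P?) i) (to T-≡ (fromWitness {a? = P? i} Pi))))

  ⊆-⊄⇒⊇ : ∀ {m} {p q : Subset m} → p ⊆ q → ¬ (p ⊂ q) → q ⊆ p
  ⊆-⊄⇒⊇ {p = p} p⊆q p⊄q {x} x∈q with x ∈? p
  ... | yes x∈p = x∈p
  ... | no  x∉p = contradiction ((λ {y} → p⊆q {y}) , x , x∈q , x∉p) p⊄q

  module _ {m : ℕ} (F : Subset m → Subset m) (F-mono : ∀ {p q} → p ⊆ q → F p ⊆ F q) where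

    iterate : ℕ → Subset m
    iterate zero    = ⊥
    iterate (suc j) = F (iterate j)

    iterate-⊆-suc : ∀ j → iterate j ⊆ iterate (suc j)
    iterate-⊆-suc zero    = ⊥⊆
    iterate-⊆-suc (suc j) = F-mono (iterate-⊆-suc j)

    -- Each non-stable step adds an element, so after m steps we are stable or have everything.
    stable-or-large : ∀ j → F (iterate j) ⊆ iterate j ⊎ j ≤ ∣ iterate j ∣
    stable-or-large zero = inj₂ z≤n
    stable-or-large (suc j) with stable-or-large j
    ... | inj₁ stable = inj₁ (F-mono stable)
    ... | inj₂ j≤ with iterate j ⊂? iterate (suc j)
    ...   | yes grows  = inj₂ (≤-trans (s≤s j≤) (p⊂q⇒∣p∣<∣q∣ grows))
    ...   | no  ¬grows = inj₁ (F-mono (⊆-⊄⇒⊇ (iterate-⊆-suc j) ¬grows))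

    lfp : Subset m
    lfp = iterate m

    lfp-closed : F lfp ⊆ lfp
    lfp-closed with stable-or-large m
    ... | inj₁ stable = stable
    ... | inj₂ m≤ = λ _ → subst (_ ∈ₛ_) (sym (∣p∣≡n⇒p≡⊤ (≤-antisym (∣p∣≤n lfp) m≤))) ∈⊤

    lfp-induction : (P : Fin m → Set) → (∀ {p} → (∀ {i} → i ∈ₛ p → P i) → ∀ {i} → i ∈ₛ F p → P i) →
                    ∀ {i} → i ∈ₛ lfp → P i
    lfp-induction P F-preserves = go m
      where
      go : ∀ j {i} → i ∈ₛ iterate j → P i
      go zero    i∈⊥ = contradiction i∈⊥ ∉⊥
      go (suc j)     = F-preserves (go j)

module LeftCorner {k : ℕ} (G : CFG (Fin k)) where
  open CFG G
  open LeastFixedPoint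
  open import Data.Fin using (_≟_; _↑ˡ_; _↑ʳ_; join; splitAt; combine; remQuot)
  open import Data.Fin.Properties using (splitAt-↑ˡ; splitAt-↑ʳ; splitAt-join; remQuot-combine)
  open import Data.Nat using (_*_)
  open import Data.Product using (uncurry)
  open import Data.Sum using ([_,_]′)
  open import Data.Fin.Subset using (Subset; _⊆_) renaming (_∈_ to _∈ₛ_)
  open import Data.Fin.Subset.Properties using (_∈?_)
  open import Data.List.Properties using (++-conicalˡ; ++-conicalʳ)
  open import Data.List.Relation.Unary.All as All using (All; []; _∷_; all?)
  open import Data.List.Relation.Unary.Any as Any using (Any; any?)
  open import Relation.Binary.Construct.Closure.ReflexiveTransitive using (Star; ε; _◅_; _◅◅_)
  open import Data.Sum.Properties using (≡-dec)
  open import Relation.Nullary using (Dec; no)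
  open import Relation.Nullary.Decidable as Dec using (isYes; toWitness; fromWitness; _×-dec_; _⊎-dec_)
  open import Relation.Unary using (Decidable)

  Sym : Set
  Sym = Fin nNT ⊎ Fin k

  Form : Set
  Form = List Sym

  _≟ₛ_ : (s t : Sym) → Dec (s ≡ t)
  _≟ₛ_ = ≡-dec _≟_ _≟_

  Nullable : Fin nNT → Set
  Nullable M = Parse G [ inj₁ M ] []

  data Nonterminal∈ (p : Subset nNT) : Sym → Set where
    nonterminal : ∀ {M} → M ∈ₛ p → Nonterminal∈ p (inj₁ M)

  nonterminal∈? : ∀ p → Decidable (Nonterminal∈ p)
  nonterminal∈? p (inj₁ M) = Dec.map′ nonterminal (λ { (nonterminal M∈p) → M∈p }) (M ∈? p)
  nonterminal∈? p (inj₂ a) = no λ ()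

  nullableStep : Subset nNT → Subset nNT
  nullableStep p = subsetOf (λ M → any? (λ (N , γ) → (N ≟ M) ×-dec all? (nonterminal∈? p) γ) prods)

  nullableStep-mono : ∀ {p q} → p ⊆ q → nullableStep p ⊆ nullableStep q
  nullableStep-mono p⊆q M∈ =
    from (∈-subsetOf⇔ _) (Any.map (λ (N≡M , allγ) → N≡M , All.map widen allγ) (to (∈-subsetOf⇔ _) M∈))
    where
    widen : ∀ {s} → Nonterminal∈ _ s → Nonterminal∈ _ s
    widen (nonterminal M∈p) = nonterminal (p⊆q M∈p)

  nullables : Subset nNT
  nullables = lfp nullableStep nullableStep-mono

  All⇒Parse-[] : ∀ {p} → (∀ {M} → M ∈ₛ p → Nullable M) → ∀ {γ} → All (Nonterminal∈ p) γ → Parse G γ []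
  All⇒Parse-[] nullable-p []                          = []
  All⇒Parse-[] nullable-p (nonterminal M∈p ∷ allγ) =
    Parse-++⁺ G (nullable-p M∈p) (All⇒Parse-[] nullable-p allγ)

  nullables-sound : ∀ {M} → M ∈ₛ nullables → Nullable M
  nullables-sound = lfp-induction nullableStep nullableStep-mono Nullable step-sound
    where
    step-sound : ∀ {p} → (∀ {M} → M ∈ₛ p → Nullable M) → ∀ {M} → M ∈ₛ nullableStep p → Nullable M
    step-sound nullable-p M∈ with find (to (∈-subsetOf⇔ _) M∈)
    ... | _ , N→γ∈ , refl , allγ = node N→γ∈ (All⇒Parse-[] nullable-p allγ) [] refl

  Parse-[]⇒All : ∀ {α w} → Parse G α w → w ≡ [] → All (Nonterminal∈ nullables) α
  Parse-[]⇒All []         _ = []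
  Parse-[]⇒All (term _)   ()
  Parse-[]⇒All (node {n} {γ} {w₁ = w₁} {w₂} n→γ pγ pα refl) w≡[] =
    nonterminal (lfp-closed nullableStep nullableStep-mono
      (from (∈-subsetOf⇔ _) (lose n→γ (refl , Parse-[]⇒All pγ (++-conicalˡ w₁ w₂ w≡[])))))
    ∷ Parse-[]⇒All pα (++-conicalʳ w₁ w₂ w≡[])

  Parse-[]⇔All : ∀ {α} → Parse G α [] ⇔ All (Nonterminal∈ nullables) α
  Parse-[]⇔All = mk⇔ (λ p → Parse-[]⇒All p refl) (All⇒Parse-[] nullables-sound)

  -- Opaque: unfolding the fixed-point iteration during unification makes type checking explode.
  opaque
    nullable : Fin nNT → Bool
    nullable M = isYes (M ∈? nullables)

    nullable⇔ : ∀ M → T (nullable M) ⇔ Nullable M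
    nullable⇔ M = mk⇔ (nullables-sound ∘ toWitness)
      (λ p → fromWitness (case Parse-[]⇒All p refl of λ { (nonterminal M∈ ∷ []) → M∈ }))

  nullableSym : Sym → Bool
  nullableSym (inj₁ M) = nullable M
  nullableSym (inj₂ a) = false

  data NullablePrefix : Form → Form → Set where
    []  : ∀ {γ} → NullablePrefix γ γ
    _∷_ : ∀ {M γ₀ γ} → Nullable M → NullablePrefix γ₀ γ → NullablePrefix (inj₁ M ∷ γ₀) γ

  NullablePrefix-Parse : ∀ {γ₀ γ w} → NullablePrefix γ₀ γ → Parse G γ w → Parse G γ₀ w
  NullablePrefix-Parse []       p = p
  NullablePrefix-Parse (n ∷ np) p = Parse-++⁺ G n (NullablePrefix-Parse np p)

  NullablePrefix-∷ʳ : ∀ {γ₀ M γ} → NullablePrefix γ₀ (inj₁ M ∷ γ) → Nullable M → NullablePrefix γ₀ γ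
  NullablePrefix-∷ʳ []       n = n ∷ []
  NullablePrefix-∷ʳ (m ∷ np) n = m ∷ NullablePrefix-∷ʳ np n

  after : Sym → Form → List Form
  after s []      = []
  after s (t ∷ γ) = when (isYes (t ≟ₛ s)) [ γ ] ++ when (nullableSym t) (after s γ)

  ∈-after⇔ : ∀ s γ {δ} → δ ∈ after s γ ⇔ NullablePrefix γ (s ∷ δ)
  ∈-after⇔ s γ = mk⇔ (forth γ) back
    where
    forth : ∀ γ {δ} → δ ∈ after s γ → NullablePrefix γ (s ∷ δ)
    forth (t ∷ γ) δ∈ with ∈-++⁻ (when (isYes (t ≟ₛ s)) [ γ ]) δ∈
    ... | inj₁ δ∈here with to (∈-when⇔ (isYes (t ≟ₛ s))) δ∈here
    ...   | t≡s , here refl rewrite toWitness t≡s = []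
    forth (inj₁ M ∷ γ) δ∈ | inj₂ δ∈later with to (∈-when⇔ (nullable M)) δ∈later
    ...   | nM , δ∈γ = to (nullable⇔ M) nM ∷ forth γ δ∈γ
    back : ∀ {γ δ} → NullablePrefix γ (s ∷ δ) → δ ∈ after s γ
    back {s ∷ δ} [] = ∈-++⁺ˡ (from (∈-when⇔ (isYes (s ≟ₛ s))) (fromWitness refl , here refl))
    back {inj₁ M ∷ γ} (n ∷ np) =
      ∈-++⁺ʳ (when (isYes (inj₁ M ≟ₛ s)) [ γ ]) (from (∈-when⇔ (nullable M)) (from (nullable⇔ M) n , back np))

  -- Climb N Z v: a path up the left spine of a derivation tree, from a node Z to the root N;
  -- v is what the rules along the path derive to the right of the spine.
  data Climb (N : Fin nNT) : Fin nNT → List (Fin k) → Set where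
    top : Climb N N []
    up  : ∀ {Z P γ δ w w₁ w₂} → (P , γ) ∈ prods → NullablePrefix γ (inj₁ Z ∷ δ) →
          Parse G δ w₁ → Climb N P w₂ → w ≡ w₁ ++ w₂ → Climb N Z w

  Climb-Parse : ∀ {N Z u v} → Climb N Z v → Parse G [ inj₁ Z ] u → Parse G [ inj₁ N ] (u ++ v)
  Climb-Parse {u = u} top p = subst (Parse G _) (sym (++-identityʳ u)) p
  Climb-Parse {u = u} (up {w₁ = w₁} {w₂} P→γ np pδ c refl) p =
    subst (Parse G _) (++-assoc u w₁ w₂)
      (Climb-Parse c (node P→γ (NullablePrefix-Parse np (Parse-++⁺ G p pδ)) [] (sym (++-identityʳ _))))

  record LeftmostTerminal (N : Fin nNT) (a : Fin k) (w : List (Fin k)) : Set where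
    constructor leftmost
    field
      {P}     : Fin nNT
      {γ δ}   : Form
      {w₁ w₂} : List (Fin k)
      rule    : (P , γ) ∈ prods
      prefix  : NullablePrefix γ (inj₂ a ∷ δ)
      w≡      : w ≡ w₁ ++ w₂
      parse   : Parse G δ w₁
      climb   : Climb N P w₂

  -- Walk down the left spine until the leftmost terminal a, recording the climb back up.
  leftmostTerminal : ∀ {N Z γ₀ γ w a u v} → (Z , γ₀) ∈ prods → NullablePrefix γ₀ γ →
                     Parse G γ w → w ≡ a ∷ u → Climb N Z v → LeftmostTerminal N a (u ++ v)
  leftmostTerminal Z→γ₀ np (term pα) refl c = leftmost Z→γ₀ np refl pα c
  leftmostTerminal Z→γ₀ np (node {w₁ = []} M→γ pγ pα e) w≡ c =
    leftmostTerminal Z→γ₀ (NullablePrefix-∷ʳ np (node M→γ pγ [] refl)) pα (trans (sym e) w≡) c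
  leftmostTerminal {v = v} Z→γ₀ np (node {w₁ = b ∷ w₁} {w₂} M→γ pγ pα refl) refl c
    with leftmostTerminal M→γ [] pγ refl (up Z→γ₀ np pα c refl)
  ... | leftmost rule prefix w≡ parse climb = leftmost rule prefix (trans (++-assoc w₁ w₂ v) w≡) parse climb

  Parse-∷⇔ : ∀ N a w → Parse G [ inj₁ N ] (a ∷ w) ⇔ LeftmostTerminal N a w
  Parse-∷⇔ N a w = mk⇔ forth back
    where
    forth : Parse G [ inj₁ N ] (a ∷ w) → LeftmostTerminal N a w
    forth (node {w₁ = w₁} N→γ pγ [] e) =
      subst (LeftmostTerminal N a) (++-identityʳ w)
        (leftmostTerminal N→γ [] pγ (sym (trans e (++-identityʳ w₁))) top)
    back : LeftmostTerminal N a w → Parse G [ inj₁ N ] (a ∷ w)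
    back (leftmost {w₁ = w₁} rule prefix refl parse climb) =
      Climb-Parse climb (node rule (NullablePrefix-Parse prefix (term parse)) [] (sym (++-identityʳ (a ∷ w₁))))

  UnitStep : Fin nNT → Fin nNT → Set
  UnitStep Z P = ∃[ γ ] (P , γ) ∈ prods × ∃[ δ ] NullablePrefix γ (inj₁ Z ∷ δ) × Parse G δ []

  Reach : Fin nNT → Fin nNT → Set
  Reach = Star UnitStep

  UnitRule : Fin nNT → Fin nNT → Fin nNT × Form → Set
  UnitRule Z P (P′ , γ) = P′ ≡ P × Any (All (Nonterminal∈ nullables)) (after (inj₁ Z) γ)

  unitStep? : ∀ Z P → Dec (UnitStep Z P)
  unitStep? Z P = Dec.map′ forth back
    (any? (λ (P′ , γ) → (P′ ≟ P) ×-dec any? (all? (nonterminal∈? nullables)) (after (inj₁ Z) γ)) prods)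
    where
    forth : Any (UnitRule Z P) prods → UnitStep Z P
    forth rule∈ with find rule∈
    ... | (_ , γ) , P→γ , refl , δ∈ with find δ∈
    ...   | δ , δ∈after , allδ = γ , P→γ , δ , to (∈-after⇔ (inj₁ Z) γ) δ∈after , from Parse-[]⇔All allδ
    back : UnitStep Z P → Any (UnitRule Z P) prods
    back (γ , P→γ , δ , np , pδ) =
      lose P→γ (refl , lose (from (∈-after⇔ (inj₁ Z) γ) np) (to Parse-[]⇔All pδ))

  reachStep : Fin nNT → Subset nNT → Subset nNT
  reachStep Z p = subsetOf (λ P → (Z ≟ P) ⊎-dec any? (λ Y → (Y ∈? p) ×-dec unitStep? Y P) (allFin nNT))

  reachStep-mono : ∀ Z {p q} → p ⊆ q → reachStep Z p ⊆ reachStep Z q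
  reachStep-mono Z p⊆q P∈ with to (∈-subsetOf⇔ _) P∈
  ... | inj₁ Z≡P   = from (∈-subsetOf⇔ _) (inj₁ Z≡P)
  ... | inj₂ steps = from (∈-subsetOf⇔ _) (inj₂ (Any.map (λ (Y∈p , u) → p⊆q Y∈p , u) steps))

  reachable : Fin nNT → Subset nNT
  reachable Z = lfp (reachStep Z) (reachStep-mono Z)

  reachable-sound : ∀ {Z P} → P ∈ₛ reachable Z → Reach Z P
  reachable-sound {Z} = lfp-induction (reachStep Z) (reachStep-mono Z) (Reach Z) step-sound
    where
    step-sound : ∀ {p} → (∀ {Y} → Y ∈ₛ p → Reach Z Y) → ∀ {P} → P ∈ₛ reachStep Z p → Reach Z P
    step-sound reach-p P∈ with to (∈-subsetOf⇔ _) P∈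
    ... | inj₁ refl  = ε
    ... | inj₂ steps with find steps
    ...   | Y , _ , Y∈p , u = reach-p Y∈p ◅◅ (u ◅ ε)

  reachable-complete : ∀ {Z Y P} → Y ∈ₛ reachable Z → Reach Y P → P ∈ₛ reachable Z
  reachable-complete Y∈ ε = Y∈
  reachable-complete {Z} {Y} Y∈ (u ◅ r) = reachable-complete
    (lfp-closed (reachStep Z) (reachStep-mono Z) (from (∈-subsetOf⇔ _) (inj₂ (lose (∈-allFin Y) (Y∈ , u))))) r

  opaque
    reach : Fin nNT → Fin nNT → Bool
    reach Z P = isYes (P ∈? reachable Z)

    reach⇔ : ∀ Z P → T (reach Z P) ⇔ Reach Z P
    reach⇔ Z P = mk⇔ (reachable-sound ∘ toWitness) λ r → fromWitness
      (reachable-complete (lfp-closed (reachStep Z) (reachStep-mono Z) (from (∈-subsetOf⇔ _) (inj₁ refl))) r)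

  Climb-lift : ∀ {N Z Z′ w} → Reach Z Z′ → Climb N Z′ w → Climb N Z w
  Climb-lift ε                             c = c
  Climb-lift ((_ , P→γ , _ , np , pδ) ◅ r) c = up P→γ np pδ (Climb-lift r c) refl

  Climb-[]⇔ : ∀ N Z → Climb N Z [] ⇔ Reach Z N
  Climb-[]⇔ N Z = mk⇔ (λ c → forth c refl) (λ r → Climb-lift r top)
    where
    forth : ∀ {Z w} → Climb N Z w → w ≡ [] → Reach Z N
    forth top _ = ε
    forth (up {w₁ = w₁} {w₂} P→γ np pδ c e) w≡[] =
      (_ , P→γ , _ , np , subst (Parse G _) (++-conicalˡ w₁ w₂ (trans (sym e) w≡[])) pδ)
      ◅ forth c (++-conicalʳ w₁ w₂ (trans (sym e) w≡[]))

  record ClimbStart (N Z : Fin nNT) (a : Fin k) (w : List (Fin k)) : Set where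
    constructor start
    field
      {Z′ P}  : Fin nNT
      {γ δ}   : Form
      {w₁ w₂} : List (Fin k)
      reaches : Reach Z Z′
      rule    : (P , γ) ∈ prods
      prefix  : NullablePrefix γ (inj₁ Z′ ∷ δ)
      w≡      : w ≡ w₁ ++ w₂
      parse   : Parse G δ (a ∷ w₁)
      climb   : Climb N P w₂

  Climb-∷⇔ : ∀ N Z a w → Climb N Z (a ∷ w) ⇔ ClimbStart N Z a w
  Climb-∷⇔ N Z a w = mk⇔ (λ c → forth c refl) back
    where
    forth : ∀ {Z x} → Climb N Z x → x ≡ a ∷ w → ClimbStart N Z a w
    forth (up {w₁ = []} P→γ np pδ c e) x≡ with forth c (trans (sym e) x≡)
    ... | start r rule prefix w≡ parse climb = start ((_ , P→γ , _ , np , pδ) ◅ r) rule prefix w≡ parse climb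
    forth (up {w₁ = b ∷ w₁} P→γ np pδ c refl) refl = start ε P→γ np refl pδ c
    back : ClimbStart N Z a w → Climb N Z (a ∷ w)
    back (start r rule prefix refl parse climb) = Climb-lift r (up rule prefix parse climb refl)

  data State : Set where
    symbol   : Sym → State
    climbing : Fin nNT → Fin nNT → State

  meaning : State → Language (Fin k)
  meaning (symbol s)     = Parse G [ s ]
  meaning (climbing N Z) = Climb N Z

  syms : Form → List State
  syms = map symbol

  ⟪syms⟫⇔Parse : ∀ δ w → (meaning ⟪ syms δ ⟫) w ⇔ Parse G δ w
  ⟪syms⟫⇔Parse δ w = ⇔-trans (⇔-sym (⟪⟫-map symbol (λ _ _ → ⇔-refl) δ w)) (⟪Parse⟫⇔Parse G δ)

  ⟪∷ʳclimb⟫⇔ : ∀ r N P w → (meaning ⟪ r ++ [ climbing N P ] ⟫) w ⇔ Concat (meaning ⟪ r ⟫) (Climb N P) w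
  ⟪∷ʳclimb⟫⇔ r N P w = mk⇔
    (λ p → let split u v e pu pv = ⟪⟫-++⁻ r p in split u v e pu (to (⟪[_]⟫⇔ {I = meaning} (climbing N P)) pv))
    (λ { (split u v refl pu pv) → ⟪⟫-++⁺ r pu (from (⟪[_]⟫⇔ {I = meaning} (climbing N P)) pv) })

  δsym : Fin nNT → Fin k → FinSetWords State
  δsym N a = concatMap (λ (P , γ) → map (λ δ → syms δ ++ [ climbing N P ]) (after (inj₂ a) γ)) prods

  δsym-correct : ∀ N a w → Parse G [ inj₁ N ] (a ∷ w) ⇔ (∃[ r ] r ∈ δsym N a × (meaning ⟪ r ⟫) w)
  δsym-correct N a w = ⇔-trans (Parse-∷⇔ N a w) (mk⇔ forth back)
    where
    forth : LeftmostTerminal N a w → ∃[ r ] r ∈ δsym N a × (meaning ⟪ r ⟫) w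
    forth (leftmost {P} {γ} {δ} {w₁} {w₂} rule prefix refl parse climb′) =
      syms δ ++ [ climbing N P ] ,
      ∈-concatMap⁺′ _ rule (∈-map⁺ _ (from (∈-after⇔ (inj₂ a) γ) prefix)) ,
      from (⟪∷ʳclimb⟫⇔ (syms δ) N P w) (split w₁ w₂ refl (from (⟪syms⟫⇔Parse δ w₁) parse) climb′)
    back : ∃[ r ] r ∈ δsym N a × (meaning ⟪ r ⟫) w → LeftmostTerminal N a w
    back (r , r∈ , pr) with ∈-concatMap⁻′ _ prods r∈
    ... | (P , γ) , rule , r∈P with ∈-map⁻ _ r∈P
    ...   | δ , δ∈ , refl with to (⟪∷ʳclimb⟫⇔ (syms δ) N P w) pr
    ...     | split w₁ w₂ w≡ pδ climb′ =
      leftmost rule (to (∈-after⇔ (inj₂ a) γ) δ∈) w≡ (to (⟪syms⟫⇔Parse δ w₁) pδ) climb′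

  δform : Fin k → Form → FinSetWords State
  δform a []           = []
  δform a (inj₂ b ∷ δ) = when (isYes (a ≟ b)) [ syms δ ]
  δform a (inj₁ M ∷ δ) = map (_++ syms δ) (δsym M a) ++ when (nullable M) (δform a δ)

  δform-correct : ∀ a δ w → Parse G δ (a ∷ w) ⇔ (∃[ r ] r ∈ δform a δ × (meaning ⟪ r ⟫) w)
  δform-correct a δ w = mk⇔ (forth δ) (λ (r , r∈ , pr) → back δ r∈ pr)
    where
    forth : ∀ δ {w} → Parse G δ (a ∷ w) → ∃[ r ] r ∈ δform a δ × (meaning ⟪ r ⟫) w
    forth (inj₂ a ∷ δ) (term p) =
      syms δ , from (∈-when⇔ (isYes (a ≟ a))) (fromWitness refl , here refl) , from (⟪syms⟫⇔Parse δ _) p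
    forth (inj₁ M ∷ δ) (node {w₁ = []} M→γ pγ pδ e) with forth δ (subst (Parse G δ) (sym e) pδ)
    ... | r , r∈ , pr =
      r , ∈-++⁺ʳ (map (_++ syms δ) (δsym M a))
            (from (∈-when⇔ (nullable M)) (from (nullable⇔ M) (node M→γ pγ [] refl) , r∈)) , pr
    forth (inj₁ M ∷ δ) (node {w₁ = a ∷ w₁} {w₂} M→γ pγ pδ refl)
      with to (δsym-correct M a w₁) (node M→γ pγ [] (sym (++-identityʳ _)))
    ... | r , r∈ , pr = r ++ syms δ , ∈-++⁺ˡ (∈-map⁺ (_++ syms δ) r∈) , ⟪⟫-++⁺ r pr (from (⟪syms⟫⇔Parse δ w₂) pδ)
    back : ∀ δ {w r} → r ∈ δform a δ → (meaning ⟪ r ⟫) w → Parse G δ (a ∷ w)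
    back (inj₂ b ∷ δ) r∈ pr with to (∈-when⇔ (isYes (a ≟ b))) r∈
    ... | a≡b , here refl rewrite toWitness a≡b = term (to (⟪syms⟫⇔Parse δ _) pr)
    back (inj₁ M ∷ δ) r∈ pr with ∈-++⁻ (map (_++ syms δ) (δsym M a)) r∈
    ... | inj₁ r∈δsym with ∈-map⁻ (_++ syms δ) r∈δsym
    ...   | r′ , r′∈ , refl with ⟪⟫-++⁻ r′ pr
    ...     | split w₁ w₂ refl p₁ p₂ =
      Parse-++⁺ G (from (δsym-correct M a w₁) (r′ , r′∈ , p₁)) (to (⟪syms⟫⇔Parse δ w₂) p₂)
    back (inj₁ M ∷ δ) r∈ pr | inj₂ r∈later with to (∈-when⇔ (nullable M)) r∈later
    ... | nM , r∈δ = Parse-++⁺ G (to (nullable⇔ M) nM) (back δ r∈δ pr)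

  δrule : Fin nNT → Fin k → Fin nNT → Fin nNT × Form → FinSetWords State
  δrule N a Z′ (P , γ) = concatMap (λ δ → map (_++ [ climbing N P ]) (δform a δ)) (after (inj₁ Z′) γ)

  δclimb : Fin nNT → Fin nNT → Fin k → FinSetWords State
  δclimb N Z a = concatMap (λ Z′ → when (reach Z Z′) (concatMap (δrule N a Z′) prods)) (allFin nNT)

  δclimb-correct : ∀ N Z a w → Climb N Z (a ∷ w) ⇔ (∃[ r ] r ∈ δclimb N Z a × (meaning ⟪ r ⟫) w)
  δclimb-correct N Z a w = ⇔-trans (Climb-∷⇔ N Z a w) (mk⇔ forth back)
    where
    forth : ClimbStart N Z a w → ∃[ r ] r ∈ δclimb N Z a × (meaning ⟪ r ⟫) w
    forth (start {Z′} {P} {γ} {δ} {w₁} {w₂} r rule prefix refl parse climb′)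
      with to (δform-correct a δ w₁) parse
    ... | r′ , r′∈ , pr′ =
      r′ ++ [ climbing N P ] ,
      ∈-concatMap⁺′ _ (∈-allFin Z′) (from (∈-when⇔ (reach Z Z′)) (from (reach⇔ Z Z′) r ,
        ∈-concatMap⁺′ _ rule (∈-concatMap⁺′ _ (from (∈-after⇔ (inj₁ Z′) γ) prefix) (∈-map⁺ _ r′∈)))) ,
      from (⟪∷ʳclimb⟫⇔ r′ N P _) (split w₁ w₂ refl pr′ climb′)
    back : ∃[ r ] r ∈ δclimb N Z a × (meaning ⟪ r ⟫) w → ClimbStart N Z a w
    back (r , r∈ , pr) with ∈-concatMap⁻′ _ (allFin nNT) r∈
    ... | Z′ , _ , r∈Z′ with to (∈-when⇔ (reach Z Z′)) r∈Z′
    ... | Z↝Z′ , r∈rules with ∈-concatMap⁻′ _ prods r∈rules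
    ... | (P , γ) , rule , r∈rule with ∈-concatMap⁻′ _ (after (inj₁ Z′) γ) r∈rule
    ... | δ , δ∈ , r∈δ with ∈-map⁻ _ r∈δ
    ... | r′ , r′∈ , refl with to (⟪∷ʳclimb⟫⇔ r′ N P w) pr
    ... | split w₁ w₂ w≡ pr′ climb′ =
      start (to (reach⇔ Z Z′) Z↝Z′) rule (to (∈-after⇔ (inj₁ Z′) γ) δ∈) w≡
            (from (δform-correct a δ w₁) (r′ , r′∈ , pr′)) climb′

  nullableSym⇔ : ∀ s → T (nullableSym s) ⇔ Parse G [ s ] []
  nullableSym⇔ (inj₁ M) = nullable⇔ M
  nullableSym⇔ (inj₂ b) = mk⇔ (λ ()) (λ ())

  oState : State → Bool
  oState (symbol s)     = nullableSym s
  oState (climbing N Z) = reach Z N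

  δState : State → Fin k → FinSetWords State
  δState (symbol s)     a = δform a [ s ]
  δState (climbing N Z) a = δclimb N Z a

  meaning-isSolution : IsSolution oState δState meaning
  meaning-isSolution = record { ε⇔ = ε⇔ ; ∷⇔ = ∷⇔ }
    where
    ε⇔ : ∀ x → meaning x [] ⇔ T (oState x)
    ε⇔ (symbol s)     = ⇔-sym (nullableSym⇔ s)
    ε⇔ (climbing N Z) = ⇔-trans (Climb-[]⇔ N Z) (⇔-sym (reach⇔ Z N))
    ∷⇔ : ∀ x a w → meaning x (a ∷ w) ⇔ (∃[ r ] r ∈ δState x a × (meaning ⟪ r ⟫) w)
    ∷⇔ (symbol s)     a w = δform-correct a [ s ] w
    ∷⇔ (climbing N Z) a w = δclimb-correct N Z a w

  size : ℕ
  size = (nNT + k) + nNT * nNT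

  encode : State → Fin size
  encode (symbol s)     = join nNT k s ↑ˡ (nNT * nNT)
  encode (climbing N Z) = (nNT + k) ↑ʳ combine N Z

  decode : Fin size → State
  decode i = [ symbol ∘ splitAt nNT , uncurry climbing ∘ remQuot nNT ]′ (splitAt (nNT + k) i)

  decode∘encode : ∀ x → decode (encode x) ≡ x
  decode∘encode (symbol s)
    rewrite splitAt-↑ˡ (nNT + k) (join nNT k s) (nNT * nNT) | splitAt-join nNT k s = refl
  decode∘encode (climbing N Z) rewrite splitAt-↑ʳ (nNT + k) (nNT * nNT) (combine N Z) =
    cong (uncurry climbing) (remQuot-combine N Z)

  oFin : Fin size → Bool
  oFin = oState ∘ decode

  δFin : Fin size → Fin k → FinSetWords (Fin size)
  δFin i a = map (map encode) (δState (decode i) a)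

  generated⇔⟦⟧ : ∀ n w → generated G n w ⇔ Extension.⟦_⟧ oFin δFin [ [ encode (symbol (inj₁ n)) ] ] w
  generated⇔⟦⟧ n w =
    ⇔-trans (generated⇔Parse G n w)
   (⇔-trans (subst (λ x → meaning (symbol (inj₁ n)) w ⇔ meaning x w) (sym (decode∘encode (symbol (inj₁ n)))) ⇔-refl)
            (Operational.solution-unique oFin δFin (relabel-isSolution encode decode decode∘encode meaning-isSolution) _ w))

theorem3p8 : (k : ℕ) (L : Language (Fin k)) →
    (IsContextFree L ⇔ Condition2 L) × (Condition2 L ⇔ Condition3 L)
theorem3p8 k L = mk⇔ cf⇒2 2⇒cf , mk⇔ 2⇒3 3⇒2
  where
  cf⇒2 : IsContextFree L → Condition2 L
  cf⇒2 (G , n , L≐G) =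
    size , oFin , δFin , encode (symbol (inj₁ n)) , λ w → ⇔-sym (⇔-trans (L≐G w) (generated⇔⟦⟧ n w))
    where open LeftCorner G

  2⇒cf : Condition2 L → IsContextFree L
  2⇒cf (m , o , δ , x , ⟦x⟧≐L) = grammar , x , λ w → ⇔-trans (⇔-sym (⟦x⟧≐L w)) (⇔-sym (generated⇔⟦⟧ x w))
    where open CoalgebraGrammar o δ

  2⇒3 : Condition2 L → Condition3 L
  2⇒3 (m , o , δ , x , ⟦x⟧≐L) = m , o , δ , [ [ x ] ] , ⟦x⟧≐L

  3⇒2 : Condition3 L → Condition2 L
  3⇒2 (m , o , δ , S , ⟦S⟧≐L) = suc m , o⁺ , δ⁺ , zero , λ w → ⇔-trans (⟦fresh⟧⇔⟦S⟧ w) (⟦S⟧≐L w)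
    where open FreshState o δ S
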